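{- Let $d\geq n$ be positive integers, let $H_1,\ldots,H_q\subseteq[d]$ and let $r_1,\ldots,r_q$ be positive integers such that $|H_i\cap H_j|\leq r_i+r_j-n$ for all $i\neq j$, and $|[d]\setminus H_i|\geq n-r_i$, $r_i\leq n-1$, $|H_i|\geq r_i+1$ for all $i\in[q]$. Let $M$ be the elementary split matroid of $\mathcal{H}=\{H_1,\ldots,H_q\}$. Then the set of subspaces of $M$ is exactly $\mathcal{L}_M=\{H_1,\ldots,H_q\}$ (each subspace being identified with the set of points belonging to it).
   Context: Elementary split matroid: for data as in the claim, the family $\mathcal{I}=\{X\subseteq[d]: |X|\leq n,\ |X\cap H_i|\leq r_i \text{ for all } i\in[q]\}$ is the family of independent sets of a matroid $M$ of rank $n$ on $[d]$, called the elementary split matroid of $\mathcal{H}$. Subspaces: for a matroid $M$ of rank $n$ with rank function $\mathrm{rank}$ and closure $\mathrm{cl}(F)=\{x:\mathrm{rank}(F\cup\{x\})=\mathrm{rank}(F)\}$, consider the circuits of $M$ of size at most $n$, and call two such circuits $C_1,C_2$ equivalent if $\mathrm{cl}(C_1)=\mathrm{cl}(C_2)$. An equivalence class $l$ is a subspace of $M$; $\mathrm{rank}(l)$ is the rank of any circuit in $l$; a point $p$ belongs to $l$ if some circuit in $l$ contains $p$, and $l$ is identified with the set of points belonging to it. $\mathcal{L}_M$ denotes the set of subspaces. -}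

module Defs where

open import Data.Nat using (ℕ; zero; suc; _≤_; _<_; _⊔_; _≟_)
open import Data.Bool using (Bool; true; false; _∧_; if_then_else_)
open import Data.Fin using (Fin)
open import Data.Fin.Subset using (Subset; _∈_; _⊆_; _⊂_; _∩_; _∪_; ⁅_⁆; ∣_∣; inside; outside)
open import Data.Fin.Subset.Properties using (_⊆?_)
open import Data.List using (List; []; _∷_; map; _++_; foldr)
open import Data.Vec using (_∷_; []; tabulate)
open import Data.Product using (Σ; ∃; _×_)
open import Relation.Nullary using (¬_; Dec; yes; no; does)
open import Relation.Binary.PropositionalEquality using (_≡_)
open import Data.Fin.Properties using (all?)
open import Data.Nat.Properties using (_≤?_)
open import Relation.Nullary.Decidable using (_×-dec_)

allSubsets : (d : ℕ) → List (Subset d)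
allSubsets zero = [] ∷ []
allSubsets (suc d) = map (outside ∷_) (allSubsets d) ++ map (inside ∷_) (allSubsets d)

module SplitMatroid {d q : ℕ} (n : ℕ) (H : Fin q → Subset d) (r : Fin q → ℕ) where

  Independent : Subset d → Set
  Independent X = (∣ X ∣ ≤ n) × (∀ i → ∣ X ∩ H i ∣ ≤ r i)

  independent? : (X : Subset d) → Dec (Independent X)
  independent? X = (∣ X ∣ ≤? n) ×-dec all? (λ i → ∣ X ∩ H i ∣ ≤? r i)

  rank : Subset d → ℕ
  rank X = foldr (λ Y m → (if does (Y ⊆? X) ∧ does (independent? Y) then ∣ Y ∣ else 0) ⊔ m)
                 0 (allSubsets d)

  cl : Subset d → Subset d
  cl F = tabulate (λ x → does (rank (F ∪ ⁅ x ⁆) ≟ rank F))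

  Circuit : Subset d → Set
  Circuit C = (¬ Independent C) × (∀ Y → Y ⊂ C → Independent Y)

  -- circuits of size at most n (= rank of M)
  SmallCircuit : Subset d → Set
  SmallCircuit C = Circuit C × (∣ C ∣ ≤ n)

  -- S is (the point set of) a subspace: S is the set of points of the
  -- equivalence class of some small circuit C₀ (circuits C with cl C = cl C₀).
  IsSubspace : Subset d → Set
  IsSubspace S = Σ (Subset d) λ C₀ → SmallCircuit C₀ ×
    (∀ p → (p ∈ S → ∃ λ C → SmallCircuit C × (cl C ≡ cl C₀) × (p ∈ C))
         × ((∃ λ C → SmallCircuit C × (cl C ≡ cl C₀) × (p ∈ C)) → p ∈ S))

module Submission where

-- A dependent set of size at most n must overload some H i, and minimality
-- then forces a small circuit to be an (r i + 1)-subset of H i; conversely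
-- every such subset is a small circuit.  From |H i ∩ H j| + n ≤ r i + r j and
-- r i < n we get |H i ∩ H j| < r j for j ≢ i, so an r i-subset of H i stays
-- independent after adding any point outside H i: the closure of an
-- (r i + 1)-subset of H i is exactly H i.  Since |H i| > r i, every point of
-- H i lies on such a circuit, hence the class of these circuits covers H i
-- and nothing else.

open import Defs
open import Data.Nat using (ℕ; zero; suc; _≤_; _<_; _+_; _⊔_; z≤n; s≤s; _≟_)
open import Data.Nat.Properties
open import Data.Bool using (true; _∧_; if_then_else_)
open import Data.Fin using (Fin)
import Data.Fin as Fin
open import Data.Fin.Properties using (¬∀⟶∃¬)
open import Data.Fin.Subset
open import Data.Fin.Subset.Properties
open import Data.Vec using ([]; _∷_; here; there)
open import Data.Vec.Properties using (lookup∘tabulate; []=⇒lookup; lookup⇒[]=)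
open import Data.List as List using (foldr)
open import Data.List.Membership.Propositional using () renaming (_∈_ to _∈ₗ_)
open import Data.List.Membership.Propositional.Properties using (∈-map⁺; ∈-++⁺ˡ; ∈-++⁺ʳ)
open import Data.List.Relation.Unary.Any using () renaming (here to hereₗ; there to thereₗ)
open import Data.Product using (∃; _×_; _,_; proj₁; proj₂)
open import Data.Sum using ([_,_]′)
open import Function using (id)
open import Relation.Nullary using (¬_; Dec; yes; no; does; contradiction)
open import Relation.Nullary.Decidable using (dec-true)
open import Relation.Binary.PropositionalEquality using (_≡_; _≢_; refl; sym; trans; cong; subst; module ≡-Reasoning)

private
  variable
    d : ℕ
    p p′ q : Subset d
    x : Fin d

a+n≤b+c∧b<n⇒a<c : ∀ {a b c n} → a + n ≤ b + c → b < n → a < c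
a+n≤b+c∧b<n⇒a<c {a} {b} {c} {n} a+n≤b+c b<n = +-cancelʳ-≤ b (suc a) c (begin
    suc a + b  ≡⟨ +-suc a b ⟨
    a + suc b  ≤⟨ +-monoʳ-≤ a b<n ⟩
    a + n      ≤⟨ a+n≤b+c ⟩
    b + c      ≡⟨ +-comm b c ⟩
    c + b      ∎)
  where open ≤-Reasoning

∪-lub : p ⊆ q → p′ ⊆ q → p ∪ p′ ⊆ q
∪-lub p⊆q p′⊆q x∈p∪p′ = [ p⊆q , p′⊆q ]′ (x∈p∪q⁻ _ _ x∈p∪p′)

∪-monoˡ-⊆ : p ⊆ p′ → p ∪ q ⊆ p′ ∪ q
∪-monoˡ-⊆ p⊆p′ = ∪-lub (⊆-trans p⊆p′ (p⊆p∪q _)) (q⊆p∪q _ _)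

∩-monoˡ-⊆ : p ⊆ p′ → p ∩ q ⊆ p′ ∩ q
∩-monoˡ-⊆ p⊆p′ x∈p∩q with x∈p , x∈q ← x∈p∩q⁻ _ _ x∈p∩q = x∈p∩q⁺ (p⊆p′ x∈p , x∈q)

⁅x⁆⊆p : x ∈ p → ⁅ x ⁆ ⊆ p
⁅x⁆⊆p {p = p} x∈p y∈⁅x⁆ = subst (_∈ p) (sym (x∈⁅y⁆⇒x≡y _ y∈⁅x⁆)) x∈p

p⊆q⇒∣p∣≤∣p∩q∣ : p ⊆ q → ∣ p ∣ ≤ ∣ p ∩ q ∣
p⊆q⇒∣p∣≤∣p∩q∣ p⊆q = p⊆q⇒∣p∣≤∣q∣ (λ x∈p → x∈p∩q⁺ (x∈p , p⊆q x∈p))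

x∉p-x : ∀ (x : Fin d) p → x ∉ p - x
x∉p-x Fin.zero    (_ ∷ p) ()
x∉p-x (Fin.suc x) (_ ∷ p) (there x∈p-x) = x∉p-x x p x∈p-x

x∉q⇒p∩q⊆p-x∩q : x ∉ q → p ∩ q ⊆ (p - x) ∩ q
x∉q⇒p∩q⊆p-x∩q {q = q} {p = p} x∉q y∈p∩q with y∈p , y∈q ← x∈p∩q⁻ p q y∈p∩q =
  x∈p∩q⁺ (x∈p∧x≢y⇒x∈p-y y∈p (λ { refl → x∉q y∈q }) , y∈q)

x∉q⇒[p∪⁅x⁆]∩q⊆p : x ∉ q → (p ∪ ⁅ x ⁆) ∩ q ⊆ p
x∉q⇒[p∪⁅x⁆]∩q⊆p {x = x} {q = q} {p = p} x∉q y∈ with y∈p∪⁅x⁆ , y∈q ← x∈p∩q⁻ _ q y∈ =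
  [ id , (λ y∈⁅x⁆ → contradiction (subst (_∈ q) (x∈⁅y⁆⇒x≡y x y∈⁅x⁆) y∈q) x∉q) ]′
    (x∈p∪q⁻ p ⁅ x ⁆ y∈p∪⁅x⁆)

[p∪⁅x⁆]∩q⊆[p∩q]∪⁅x⁆ : (p ∪ ⁅ x ⁆) ∩ q ⊆ (p ∩ q) ∪ ⁅ x ⁆
[p∪⁅x⁆]∩q⊆[p∩q]∪⁅x⁆ {p = p} {x = x} {q = q} y∈ with y∈p∪⁅x⁆ , y∈q ← x∈p∩q⁻ _ q y∈ =
  [ (λ y∈p → p⊆p∪q ⁅ x ⁆ (x∈p∩q⁺ (y∈p , y∈q))) , q⊆p∪q (p ∩ q) ⁅ x ⁆ ]′
    (x∈p∪q⁻ p ⁅ x ⁆ y∈p∪⁅x⁆)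

∣p∣≡1+∣p-x∣ : x ∈ p → ∣ p ∣ ≡ suc ∣ p - x ∣
∣p∣≡1+∣p-x∣ {p = inside ∷ p}  here            = cong suc (cong ∣_∣ (sym (p─⊥≡p p)))
∣p∣≡1+∣p-x∣ {p = inside ∷ p}  (there x∈p)     = cong suc (∣p∣≡1+∣p-x∣ x∈p)
∣p∣≡1+∣p-x∣ {p = outside ∷ p} (there x∈p)     = ∣p∣≡1+∣p-x∣ x∈p

∣p∪⁅x⁆∣≡1+∣p∣ : x ∉ p → ∣ p ∪ ⁅ x ⁆ ∣ ≡ suc ∣ p ∣
∣p∪⁅x⁆∣≡1+∣p∣ {x = Fin.zero}  {inside ∷ p}  x∉p = contradiction here x∉p
∣p∪⁅x⁆∣≡1+∣p∣ {x = Fin.zero}  {outside ∷ p} x∉p = cong suc (cong ∣_∣ (∪-identityʳ p))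
∣p∪⁅x⁆∣≡1+∣p∣ {x = Fin.suc x} {inside ∷ p}  x∉p = cong suc (∣p∪⁅x⁆∣≡1+∣p∣ (λ x∈p → x∉p (there x∈p)))
∣p∪⁅x⁆∣≡1+∣p∣ {x = Fin.suc x} {outside ∷ p} x∉p = ∣p∪⁅x⁆∣≡1+∣p∣ (λ x∈p → x∉p (there x∈p))

∣p∪⁅x⁆∣≤1+∣p∣ : ∀ (x : Fin d) p → ∣ p ∪ ⁅ x ⁆ ∣ ≤ suc ∣ p ∣
∣p∪⁅x⁆∣≤1+∣p∣ Fin.zero    (inside ∷ p)  = s≤s (≤-trans (≤-reflexive (cong ∣_∣ (∪-identityʳ p))) (n≤1+n _))
∣p∪⁅x⁆∣≤1+∣p∣ Fin.zero    (outside ∷ p) = s≤s (≤-reflexive (cong ∣_∣ (∪-identityʳ p)))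
∣p∪⁅x⁆∣≤1+∣p∣ (Fin.suc x) (inside ∷ p)  = s≤s (∣p∪⁅x⁆∣≤1+∣p∣ x p)
∣p∪⁅x⁆∣≤1+∣p∣ (Fin.suc x) (outside ∷ p) = ∣p∪⁅x⁆∣≤1+∣p∣ x p

∣p∣>0⇒Nonempty : 0 < ∣ p ∣ → Nonempty p
∣p∣>0⇒Nonempty {p = inside ∷ p}  _       = Fin.zero , here
∣p∣>0⇒Nonempty {p = outside ∷ p} ∣p∣>0 with x , x∈p ← ∣p∣>0⇒Nonempty ∣p∣>0 = Fin.suc x , there x∈p

⊆-ofSize : ∀ (p : Subset d) k → k ≤ ∣ p ∣ → ∃ λ q → q ⊆ p × ∣ q ∣ ≡ k
⊆-ofSize []            zero    _ = [] , (λ ()) , refl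
⊆-ofSize {d} p@(_ ∷ _) zero    _ = ⊥ , ⊆-min p , ∣⊥∣≡0 d
⊆-ofSize (outside ∷ p) k       k≤∣p∣ with q , q⊆p , ∣q∣≡k ← ⊆-ofSize p k k≤∣p∣ =
  outside ∷ q , s⊆s q⊆p , ∣q∣≡k
⊆-ofSize (inside ∷ p)  (suc k) (s≤s k≤∣p∣) with q , q⊆p , ∣q∣≡k ← ⊆-ofSize p k k≤∣p∣ =
  inside ∷ q , s⊆s q⊆p , cong suc ∣q∣≡k

allSubsets-complete : ∀ (p : Subset d) → p ∈ₗ allSubsets d
allSubsets-complete []                  = hereₗ refl
allSubsets-complete {suc d} (outside ∷ p) =
  ∈-++⁺ˡ (∈-map⁺ (outside ∷_) (allSubsets-complete p))
allSubsets-complete {suc d} (inside ∷ p)  =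
  ∈-++⁺ʳ (List.map (outside ∷_) (allSubsets d)) (∈-map⁺ (inside ∷_) (allSubsets-complete p))

module _ {A : Set} (f : A → ℕ) where

  ≤-foldr-⊔ : ∀ {a xs} → a ∈ₗ xs → f a ≤ foldr (λ b m → f b ⊔ m) 0 xs
  ≤-foldr-⊔ (hereₗ refl) = m≤m⊔n _ _
  ≤-foldr-⊔ (thereₗ a∈xs) = ≤-trans (≤-foldr-⊔ a∈xs) (m≤n⊔m _ _)

  foldr-⊔-lub : ∀ {k} xs → (∀ a → f a ≤ k) → foldr (λ b m → f b ⊔ m) 0 xs ≤ k
  foldr-⊔-lub List.[]         _     = z≤n
  foldr-⊔-lub (a List.∷ xs) f≤k = ⊔-lub (f≤k a) (foldr-⊔-lub xs f≤k)

does≡true⇒ : ∀ {A : Set} (a? : Dec A) → does a? ≡ true → A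
does≡true⇒ (yes a) _  = a
does≡true⇒ (no _)  ()

if-both-≡ : ∀ {A B : Set} (a? : Dec A) (b? : Dec B) {m} → A → B →
  (if does a? ∧ does b? then m else 0) ≡ m
if-both-≡ a? b? a b rewrite dec-true a? a | dec-true b? b = refl

if-both-≤ : ∀ {A B : Set} (a? : Dec A) (b? : Dec B) {m k} → (A → B → m ≤ k) →
  (if does a? ∧ does b? then m else 0) ≤ k
if-both-≤ (yes a) (yes b) m≤k = m≤k a b
if-both-≤ (yes _) (no _)  _   = z≤n
if-both-≤ (no _)  _       _   = z≤n

module SplitMatroidProperties {q : ℕ} (n : ℕ) (H : Fin q → Subset d) (r : Fin q → ℕ) where

  open SplitMatroid n H r

  ∣Y∣≤rank : ∀ {X Y} → Y ⊆ X → Independent Y → ∣ Y ∣ ≤ rank X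
  ∣Y∣≤rank {X} {Y} Y⊆X indY = begin
    ∣ Y ∣                                                           ≡⟨ if-both-≡ (Y ⊆? X) (independent? Y) Y⊆X indY ⟨
    (if does (Y ⊆? X) ∧ does (independent? Y) then ∣ Y ∣ else 0)    ≤⟨ ≤-foldr-⊔ _ (allSubsets-complete Y) ⟩
    rank X                                                          ∎
    where open ≤-Reasoning

  rank≤ : ∀ {X k} → (∀ Y → Y ⊆ X → Independent Y → ∣ Y ∣ ≤ k) → rank X ≤ k
  rank≤ {X} ∣Y∣≤k = foldr-⊔-lub _ (allSubsets d) (λ Y → if-both-≤ (Y ⊆? X) (independent? Y) (∣Y∣≤k Y))

  rank≤r : ∀ {i X} → X ⊆ H i → rank X ≤ r i
  rank≤r {i} X⊆H = rank≤ (λ Y Y⊆X indY → ≤-trans (p⊆q⇒∣p∣≤∣p∩q∣ (⊆-trans Y⊆X X⊆H)) (proj₂ indY i))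

  ∈-cl⁺ : ∀ {F x} → rank (F ∪ ⁅ x ⁆) ≡ rank F → x ∈ cl F
  ∈-cl⁺ {F} {x} rank≡ = lookup⇒[]= x (cl F) (trans (lookup∘tabulate _ x) (dec-true (_ ≟ _) rank≡))

  ∈-cl⁻ : ∀ {F x} → x ∈ cl F → rank (F ∪ ⁅ x ⁆) ≡ rank F
  ∈-cl⁻ {F} {x} x∈cl = does≡true⇒ (_ ≟ _) (trans (sym (lookup∘tabulate _ x)) ([]=⇒lookup x∈cl))

  HCircuit : Fin q → Subset d → Set
  HCircuit i C = C ⊆ H i × ∣ C ∣ ≡ suc (r i)

  PointOfClass : Subset d → Fin d → Set
  PointOfClass C₀ x = ∃ λ C → SmallCircuit C × (cl C ≡ cl C₀) × (x ∈ C)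

  overloaded : ∀ {C} → ¬ Independent C → ∣ C ∣ ≤ n → ∃ λ i → r i < ∣ C ∩ H i ∣
  overloaded {C} ¬indC ∣C∣≤n
    with i , ∣C∩H∣≰r ← ¬∀⟶∃¬ q _ (λ i → ∣ C ∩ H i ∣ ≤? r i) (λ ∣C∩H∣≤r → ¬indC (∣C∣≤n , ∣C∩H∣≤r))
    = i , ≰⇒> ∣C∩H∣≰r

  smallCircuit⇒HCircuit : ∀ {C} → SmallCircuit C → ∃ λ i → HCircuit i C
  smallCircuit⇒HCircuit {C} ((¬indC , minimal) , ∣C∣≤n) with i , r<∣C∩H∣ ← overloaded {C} ¬indC ∣C∣≤n =
    i , C⊆H , ≤-antisym ∣C∣≤1+r (≤-trans r<∣C∩H∣ (∣p∩q∣≤∣p∣ C (H i)))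
    where
    ∣C-x∩H∣≤r : ∀ {x} → x ∈ C → ∣ (C - x) ∩ H i ∣ ≤ r i
    ∣C-x∩H∣≤r {x} x∈C = proj₂ (minimal (C - x) (x∈p⇒p-x⊂p x∈C)) i

    C⊆H : C ⊆ H i
    C⊆H {x} x∈C with x ∈? H i
    ... | yes x∈H = x∈H
    ... | no  x∉H = contradiction
      (≤-trans (p⊆q⇒∣p∣≤∣q∣ (x∉q⇒p∩q⊆p-x∩q {p = C} x∉H)) (∣C-x∩H∣≤r x∈C)) (<⇒≱ r<∣C∩H∣)

    ∣C∣≤1+r : ∣ C ∣ ≤ suc (r i)
    ∣C∣≤1+r with c , c∈C ← ∣p∣>0⇒Nonempty {p = C} (≤-trans (s≤s z≤n) (≤-trans r<∣C∩H∣ (∣p∩q∣≤∣p∣ C (H i)))) = begin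
      ∣ C ∣                   ≡⟨ ∣p∣≡1+∣p-x∣ c∈C ⟩
      suc ∣ C - c ∣           ≤⟨ s≤s (p⊆q⇒∣p∣≤∣p∩q∣ (⊆-trans (p─q⊆p C ⁅ c ⁆) C⊆H)) ⟩
      suc ∣ (C - c) ∩ H i ∣   ≤⟨ s≤s (∣C-x∩H∣≤r c∈C) ⟩
      suc (r i)               ∎
      where open ≤-Reasoning

  module _ (∣H∩H∣+n≤r+r : ∀ i j → i ≢ j → ∣ H i ∩ H j ∣ + n ≤ r i + r j) (r<n : ∀ i → r i < n) where

    ∣H∩H∣<r : ∀ {i j} → i ≢ j → ∣ H i ∩ H j ∣ < r j
    ∣H∩H∣<r {i} {j} i≢j = a+n≤b+c∧b<n⇒a<c (∣H∩H∣+n≤r+r i j i≢j) (r<n i)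

    ∣Y∩H∣≤∣H∩H∣ : ∀ {i j Y} → Y ⊆ H i → ∣ Y ∩ H j ∣ ≤ ∣ H i ∩ H j ∣
    ∣Y∩H∣≤∣H∩H∣ Y⊆H = p⊆q⇒∣p∣≤∣q∣ (∩-monoˡ-⊆ Y⊆H)

    independent-⊆H : ∀ {i Y} → Y ⊆ H i → ∣ Y ∣ ≤ r i → Independent Y
    independent-⊆H {i} {Y} Y⊆H ∣Y∣≤r = ≤-trans ∣Y∣≤r (<⇒≤ (r<n i)) , ∣Y∩H∣≤r
      where
      ∣Y∩H∣≤r : ∀ j → ∣ Y ∩ H j ∣ ≤ r j
      ∣Y∩H∣≤r j with i Fin.≟ j
      ... | yes refl = ≤-trans (∣p∩q∣≤∣p∣ Y (H i)) ∣Y∣≤r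
      ... | no  i≢j  = ≤-trans (∣Y∩H∣≤∣H∩H∣ Y⊆H) (<⇒≤ (∣H∩H∣<r i≢j))

    independent-⊆H∪⁅x⁆ : ∀ {i Y x} → Y ⊆ H i → ∣ Y ∣ ≤ r i → x ∉ H i → Independent (Y ∪ ⁅ x ⁆)
    independent-⊆H∪⁅x⁆ {i} {Y} {x} Y⊆H ∣Y∣≤r x∉H =
      ≤-trans (∣p∪⁅x⁆∣≤1+∣p∣ x Y) (≤-trans (s≤s ∣Y∣≤r) (r<n i)) , ∣Y∪x∩H∣≤r
      where
      ∣Y∪x∩H∣≤r : ∀ j → ∣ (Y ∪ ⁅ x ⁆) ∩ H j ∣ ≤ r j
      ∣Y∪x∩H∣≤r j with i Fin.≟ j
      ... | yes refl = ≤-trans (p⊆q⇒∣p∣≤∣q∣ (x∉q⇒[p∪⁅x⁆]∩q⊆p {p = Y} x∉H)) ∣Y∣≤r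
      ... | no  i≢j  = begin
        ∣ (Y ∪ ⁅ x ⁆) ∩ H j ∣   ≤⟨ p⊆q⇒∣p∣≤∣q∣ ([p∪⁅x⁆]∩q⊆[p∩q]∪⁅x⁆ {p = Y} {x = x} {q = H j}) ⟩
        ∣ (Y ∩ H j) ∪ ⁅ x ⁆ ∣   ≤⟨ ∣p∪⁅x⁆∣≤1+∣p∣ x (Y ∩ H j) ⟩
        suc ∣ Y ∩ H j ∣         ≤⟨ s≤s (∣Y∩H∣≤∣H∩H∣ Y⊆H) ⟩
        suc ∣ H i ∩ H j ∣       ≤⟨ ∣H∩H∣<r i≢j ⟩
        r j                     ∎
        where open ≤-Reasoning

    HCircuit⇒SmallCircuit : ∀ {i C} → HCircuit i C → SmallCircuit C
    HCircuit⇒SmallCircuit {i} {C} (C⊆H , ∣C∣≡1+r) = (¬indC , minimal) , ≤-trans (≤-reflexive ∣C∣≡1+r) (r<n i)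
      where
      ¬indC : ¬ Independent C
      ¬indC (_ , ∣C∩H∣≤r) = 1+n≰n (begin
        suc (r i)     ≡⟨ ∣C∣≡1+r ⟨
        ∣ C ∣         ≤⟨ p⊆q⇒∣p∣≤∣p∩q∣ C⊆H ⟩
        ∣ C ∩ H i ∣   ≤⟨ ∣C∩H∣≤r i ⟩
        r i           ∎)
        where open ≤-Reasoning

      minimal : ∀ Y → Y ⊂ C → Independent Y
      minimal Y Y⊂C = independent-⊆H (⊆-trans (p⊂q⇒p⊆q Y⊂C) C⊆H)
        (≤-pred (≤-trans (p⊂q⇒∣p∣<∣q∣ Y⊂C) (≤-reflexive ∣C∣≡1+r)))

    cl-HCircuit : ∀ {i C} → HCircuit i C → cl C ≡ H i
    cl-HCircuit {i} {C} (C⊆H , ∣C∣≡1+r)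
      with c , c∈C ← ∣p∣>0⇒Nonempty {p = C} (subst (0 <_) (sym ∣C∣≡1+r) (s≤s z≤n))
      = ⊆-antisym cl⊆H H⊆cl
      where
      C′ : Subset d
      C′ = C - c

      C′⊆C : C′ ⊆ C
      C′⊆C = p─q⊆p C ⁅ c ⁆

      C′⊆H : C′ ⊆ H i
      C′⊆H = ⊆-trans C′⊆C C⊆H

      ∣C′∣≡r : ∣ C′ ∣ ≡ r i
      ∣C′∣≡r = suc-injective (trans (sym (∣p∣≡1+∣p-x∣ c∈C)) ∣C∣≡1+r)

      rank≡r : ∀ {X} → C ⊆ X → X ⊆ H i → rank X ≡ r i
      rank≡r C⊆X X⊆H = ≤-antisym (rank≤r X⊆H)
        (subst (_≤ rank _) ∣C′∣≡r (∣Y∣≤rank (⊆-trans C′⊆C C⊆X) (independent-⊆H C′⊆H (≤-reflexive ∣C′∣≡r))))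

      H⊆cl : H i ⊆ cl C
      H⊆cl {x} x∈H = ∈-cl⁺ (trans (rank≡r (p⊆p∪q ⁅ x ⁆) (∪-lub C⊆H (⁅x⁆⊆p x∈H))) (sym (rank≡r ⊆-refl C⊆H)))

      cl⊆H : cl C ⊆ H i
      cl⊆H {x} x∈cl with x ∈? H i
      ... | yes x∈H = x∈H
      ... | no  x∉H = contradiction (∈-cl⁻ x∈cl) rank≢
        where
        rank≢ : rank (C ∪ ⁅ x ⁆) ≢ rank C
        rank≢ rank≡ = 1+n≰n (begin
          suc (r i)               ≡⟨ cong suc ∣C′∣≡r ⟨
          suc ∣ C′ ∣              ≡⟨ ∣p∪⁅x⁆∣≡1+∣p∣ (λ x∈C′ → x∉H (C′⊆H x∈C′)) ⟨
          ∣ C′ ∪ ⁅ x ⁆ ∣          ≤⟨ ∣Y∣≤rank (∪-monoˡ-⊆ C′⊆C) (independent-⊆H∪⁅x⁆ C′⊆H (≤-reflexive ∣C′∣≡r) x∉H) ⟩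
          rank (C ∪ ⁅ x ⁆)        ≡⟨ rank≡ ⟩
          rank C                  ≡⟨ rank≡r ⊆-refl C⊆H ⟩
          r i                     ∎)
          where open ≤-Reasoning

    module _ (r<∣H∣ : ∀ i → r i < ∣ H i ∣) where

      HCircuit-through : ∀ {i x} → x ∈ H i → ∃ λ C → HCircuit i C × x ∈ C
      HCircuit-through {i} {x} x∈H
        with Y , Y⊆H-x , ∣Y∣≡r ← ⊆-ofSize (H i - x) (r i) (≤-pred (subst (r i <_) (∣p∣≡1+∣p-x∣ x∈H) (r<∣H∣ i)))
        = Y ∪ ⁅ x ⁆
        , (∪-lub (⊆-trans Y⊆H-x (p─q⊆p (H i) ⁅ x ⁆)) (⁅x⁆⊆p x∈H)
          , trans (∣p∪⁅x⁆∣≡1+∣p∣ (λ x∈Y → x∉p-x x (H i) (Y⊆H-x x∈Y))) (cong suc ∣Y∣≡r))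
        , q⊆p∪q Y ⁅ x ⁆ (x∈⁅x⁆ x)

      pointOfClass⇒∈H : ∀ {i C₀ x} → HCircuit i C₀ → PointOfClass C₀ x → x ∈ H i
      pointOfClass⇒∈H {i} {C₀} {x} hc₀ (C , scC , clC≡clC₀ , x∈C) with j , hcC ← smallCircuit⇒HCircuit scC =
        subst (x ∈_) Hj≡Hi (proj₁ hcC x∈C)
        where
        Hj≡Hi : H j ≡ H i
        Hj≡Hi = begin
          H j      ≡⟨ cl-HCircuit hcC ⟨
          cl C     ≡⟨ clC≡clC₀ ⟩
          cl C₀    ≡⟨ cl-HCircuit hc₀ ⟩
          H i      ∎
          where open ≡-Reasoning

      ∈H⇒pointOfClass : ∀ {i C₀ x} → HCircuit i C₀ → x ∈ H i → PointOfClass C₀ x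
      ∈H⇒pointOfClass hc₀ x∈H with C , hcC , x∈C ← HCircuit-through x∈H =
        C , HCircuit⇒SmallCircuit hcC , trans (cl-HCircuit hcC) (sym (cl-HCircuit hc₀)) , x∈C

      subspace⇒H : ∀ {S} → IsSubspace S → ∃ λ i → S ≡ H i
      subspace⇒H (C₀ , scC₀ , points) with i , hc₀ ← smallCircuit⇒HCircuit scC₀ =
        i , ⊆-antisym (λ x∈S → pointOfClass⇒∈H hc₀ (proj₁ (points _) x∈S))
                      (λ x∈H → proj₂ (points _) (∈H⇒pointOfClass hc₀ x∈H))

      H-subspace : ∀ i → IsSubspace (H i)
      H-subspace i
        with x , x∈H ← ∣p∣>0⇒Nonempty {p = H i} (≤-trans (s≤s z≤n) (r<∣H∣ i))
        with C₀ , hc₀ , _ ← HCircuit-through x∈H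
        = C₀ , HCircuit⇒SmallCircuit hc₀ , λ _ → ∈H⇒pointOfClass hc₀ , pointOfClass⇒∈H hc₀

lemma2p9 : (d n q : ℕ) (H : Fin q → Subset d) (r : Fin q → ℕ) →
    1 ≤ n → n ≤ d → (∀ i → 1 ≤ r i) →
    (∀ i j → i ≢ j → ∣ H i ∩ H j ∣ + n ≤ r i + r j) →
    (∀ i → n ≤ ∣ ∁ (H i) ∣ + r i) →
    (∀ i → r i < n) →
    (∀ i → r i < ∣ H i ∣) →
    ∀ (S : Subset d) →
    (SplitMatroid.IsSubspace n H r S → ∃ λ i → S ≡ H i)
    × ((∃ λ i → S ≡ H i) → SplitMatroid.IsSubspace n H r S)
lemma2p9 d n q H r _ _ _ ∣H∩H∣+n≤r+r _ r<n r<∣H∣ S =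
  subspace⇒H ∣H∩H∣+n≤r+r r<n r<∣H∣ , λ { (i , refl) → H-subspace ∣H∩H∣+n≤r+r r<n r<∣H∣ i }
  where open SplitMatroidProperties n H r
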